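{- Let $G$ be a semisimple $k$-SAT formula such that $\mathrm{type}(G)$ is isomorphic to $\vec T_k$. Then the $2$-blowup $G[2]$ has a simple non-minimal subformula.
   Context: A clause is a conjunction of $k$ literals ($x$ or $\overline x$) on $k$ distinct variables; a formula is a set of clauses; a subformula is a subset. Simple: no two clauses use the same $k$-set of variables. Minimal: each clause $C$ has an assignment satisfying $C$ and no other clause. A formula is semisimple if for every $k$-set $S$ of variables, either no clause uses exactly $S$, or exactly one does, or exactly two do and they differ in the sign of exactly one variable. A $k$-PDG on vertex set $V$ assigns to each $k$-subset either no edge, an undirected edge, or a directed edge directed toward one of its vertices. For semisimple $G$, $\mathrm{type}(G)$ is the $k$-PDG whose vertices are the variables, with an undirected edge on each $k$-set supporting exactly one clause, and a directed edge on each $k$-set supporting exactly two clauses, directed toward the variable whose sign differs between them. $\vec T_k$ is the $k$-PDG on $\{1,\dots,k+1\}$ with undirected edges $\{1,\dots,k\}$, $\{2,\dots,k+1\}$ and the edge $\{1,\dots,k-1,k+1\}$ directed toward $k+1$. The $2$-blowup $G[2]$ replaces each variable $x$ by duplicates $x,x'$ and each clause by all clauses obtained by choosing one duplicate for each of its variables (keeping signs). -}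

module Defs where

open import Data.Nat using (ℕ; zero; suc; _+_; _∸_; _≡ᵇ_)
open import Data.Bool using (Bool; true; false; not; if_then_else_; _∧_; T)
import Data.Bool.Properties as BoolP
open import Data.Maybe using (Maybe; just; nothing; is-just)
import Data.Maybe.Properties as MaybeP
open import Data.Fin using (Fin; toℕ; fromℕ; _↑ˡ_; _↑ʳ_)
open import Data.Vec using (Vec; []; _∷_; lookup; tabulate; map)
import Data.Vec.Properties as VecP
open import Data.List using (List; []; _∷_; concatMap; filterᵇ)
open import Data.Bool.ListAction using (any)
import Data.List as L
open import Data.Product using (Σ; _×_; _,_)
open import Data.Sum using (_⊎_)
open import Relation.Nullary using (¬_; does)
open import Relation.Binary.PropositionalEquality using (_≡_; _≢_)
open import Function.Bundles using (_↔_; Inverse)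

-- A clause is a vector: position i is 'nothing' if variable i does not
-- occur, 'just true' for the literal x_i, 'just false' for ¬x_i.
-- (Literals are automatically on distinct variables.)

Clause : ℕ → Set
Clause n = Vec (Maybe Bool) n

Formula : ℕ → Set
Formula n = Clause n → Bool

card : ∀ {n} → Vec Bool n → ℕ
card [] = 0
card (true ∷ s) = suc (card s)
card (false ∷ s) = card s

supp : ∀ {n} → Clause n → Vec Bool n
supp = map is-just

IsKFormula : ∀ {n} → ℕ → Formula n → Set
IsKFormula k G = ∀ C → T (G C) → card (supp C) ≡ k

_⊆F_ : ∀ {n} → Formula n → Formula n → Set
H ⊆F G = ∀ C → T (H C) → T (G C)

-- clauses are conjunctions of literals
Satisfies : ∀ {n} → Vec Bool n → Clause n → Set
Satisfies a C = ∀ i b → lookup C i ≡ just b → lookup a i ≡ b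

Simple : ∀ {n} → Formula n → Set
Simple G = ∀ C C' → T (G C) → T (G C') → supp C ≡ supp C' → C ≡ C'

Minimal : ∀ {n} → Formula n → Set
Minimal G = ∀ C → T (G C) →
  Σ _ λ a → Satisfies a C × (∀ C' → T (G C') → C' ≢ C → ¬ Satisfies a C')

DiffOne : ∀ {n} → Clause n → Clause n → Set
DiffOne C C' = Σ _ λ i → (lookup C i ≢ lookup C' i) ×
  (∀ j → j ≢ i → lookup C j ≡ lookup C' j)

Semisimple : ∀ {n} → Formula n → Set
Semisimple G = ∀ C C' → T (G C) → T (G C') → supp C ≡ supp C' → C ≢ C' →
  DiffOne C C' ×
  (∀ C'' → T (G C'') → supp C'' ≡ supp C → (C'' ≡ C) ⊎ (C'' ≡ C'))

_==C_ : ∀ {n} → Clause n → Clause n → Bool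
C ==C D = does (VecP.≡-dec (MaybeP.≡-dec BoolP._≟_) C D)

_==S_ : ∀ {n} → Vec Bool n → Vec Bool n → Bool
S ==S R = does (VecP.≡-dec BoolP._≟_ S R)

allClauses : ∀ n → List (Clause n)
allClauses zero = [] ∷ []
allClauses (suc n) = concatMap (λ v → (nothing ∷ v) ∷ (just true ∷ v) ∷ (just false ∷ v) ∷ [])
                               (allClauses n)

allChoices : ∀ n → List (Vec Bool n)
allChoices zero = [] ∷ []
allChoices (suc n) = concatMap (λ v → (false ∷ v) ∷ (true ∷ v) ∷ []) (allChoices n)

-- k-PDGs on vertex set Fin n: each k-subset S (a Vec Bool n with
-- card S ≡ k) carries no edge, an undirected edge, or an edge directed
-- toward a vertex.  Values on non-k-subsets are irrelevant.

data PEdge (n : ℕ) : Set where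
  none       : PEdge n
  undirected : PEdge n
  directed   : Fin n → PEdge n

PDG : ℕ → Set
PDG n = Vec Bool n → PEdge n

mapEdge : ∀ {n m} → (Fin n → Fin m) → PEdge n → PEdge m
mapEdge f none = none
mapEdge f undirected = undirected
mapEdge f (directed v) = directed (f v)

_≅[_]_ : ∀ {n m} → PDG n → ℕ → PDG m → Set
_≅[_]_ {n} {m} P k Q = Σ (Fin n ↔ Fin m) λ σ →
  ∀ S → card S ≡ k →
    Q (tabulate (λ j → lookup S (Inverse.from σ j))) ≡ mapEdge (Inverse.to σ) (P S)

diffs : ∀ {n} → Clause n → Clause n → List (Fin n)
diffs {n} C D = filterᵇ (λ i → not (does (MaybeP.≡-dec BoolP._≟_ (lookup C i) (lookup D i))))
                        (L.allFin n)

-- type(G) (only meaningful for semisimple G)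
type : ∀ {n} → Formula n → PDG n
type {n} G S with filterᵇ (λ C → G C ∧ (supp C ==S S)) (allClauses n)
... | [] = none
... | _ ∷ [] = undirected
... | C ∷ D ∷ [] with diffs C D
...   | i ∷ [] = directed i
...   | _ = none
type G S | _ ∷ _ ∷ _ ∷ _ = none

-- \vec T_k on vertices {1,…,k+1}, represented by Fin (k+1) via i ↦ i-1
Tk : (k : ℕ) → PDG (suc k)
Tk k S =
  if S ==S S₁ then undirected else
  if S ==S S₂ then undirected else
  if S ==S S₃ then directed (fromℕ k) else none
  where
  S₁ S₂ S₃ : Vec Bool (suc k)
  S₁ = tabulate (λ i → not (toℕ i ≡ᵇ k))        -- {1,…,k}
  S₂ = tabulate (λ i → not (toℕ i ≡ᵇ 0))        -- {2,…,k+1}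
  S₃ = tabulate (λ i → not (toℕ i ≡ᵇ (k ∸ 1)))  -- {1,…,k-1,k+1}, toward k+1

-- 2-blowup: variables Fin (n + n); variable x = i is i ↑ˡ n,
-- its duplicate x' is n ↑ʳ i.

-- blow C f: for each variable i of C, put its literal on the copy chosen by f i
blow : ∀ {n} → Clause n → Vec Bool n → Clause (n + n)
blow {n} C f = tabulate (λ j → pick j)
  where
  pick : Fin (n + n) → Maybe Bool
  pick j with Data.Fin.splitAt n j
  ... | Data.Sum.inj₁ i = if lookup f i then nothing else lookup C i
  ... | Data.Sum.inj₂ i = if lookup f i then lookup C i else nothing

blowup : ∀ {n} → Formula n → Formula (n + n)
blowup {n} G D = any (λ C → G C ∧ any (λ f → blow C f ==C D) (allChoices n)) (allClauses n)

-- Read the edges of T_k as clauses of G: A on {1,…,k}, B on {2,…,k+1}, and, of the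
-- two clauses on {1,…,k-1,k+1}, which differ exactly at p = k+1, the one C whose sign
-- at p is opposite to B's. In G[2] take A on the original copies, every copy of A with
-- a single variable moved to its duplicate, and the copies of B and C that put each
-- literal on the original when it agrees with A and on the duplicate when it disagrees.
-- Distinct clauses here have distinct variable sets, so the subformula is simple. It is
-- not minimal: an assignment satisfying the all-original copy of A either agrees with A
-- on some duplicate, and then satisfies the copy of A moved there, or gives every
-- duplicate the sign opposite to A's, and then satisfies the copy of B or of C,
-- whichever matches its value on the original of p.

module Submission where

import Algebra.Properties.CommutativeMonoid.Sum as Sum
open import Data.Bool using (Bool; true; false; not; if_then_else_; _∧_; _∨_; _xor_; T)
import Data.Bool.Properties as BoolP
open import Data.Bool.ListAction using (any)
open import Data.Empty using (⊥-elim)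
open import Data.Fin using (Fin; toℕ; fromℕ; inject₁; _↑ˡ_; _↑ʳ_; splitAt)
import Data.Fin as Fin
import Data.Fin.Properties as FinP
open import Data.List using (List; []; _∷_)
import Data.List as List
open import Data.List.Membership.Propositional using (_∈_; lose; find)
open import Data.List.Membership.Propositional.Properties using (∈-concatMap⁺; ∈-map⁻; ∈-map⁺; ∈-allFin)
open import Data.List.Relation.Unary.All using ([]; _∷_)
open import Data.List.Relation.Unary.All.Properties using (all-filter)
open import Data.List.Relation.Unary.Any using (here; there)
import Data.List.Relation.Unary.Any as Any
open import Data.List.Relation.Unary.Any.Properties using (any⁺; any⁻)
open import Data.Maybe using (Maybe; just; nothing; is-just)
import Data.Maybe.Properties as MaybeP
open import Data.Nat using (ℕ; zero; suc; _≤_; _+_; _≡ᵇ_; s≤s; z≤n)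
import Data.Nat.Properties as NatP
open import Data.Product using (Σ; _×_; _,_; proj₁; ∃)
open import Data.Sum using (_⊎_; inj₁; inj₂)
open import Data.Vec using (Vec; lookup; tabulate; replicate)
import Data.Vec.Properties as VecP
open import Data.Vec.Relation.Binary.Pointwise.Extensional using (ext; Pointwise-≡⇒≡)
open import Function using (_∘_; _↔_; Inverse; Equivalence)
open import Relation.Binary.PropositionalEquality
open import Relation.Nullary using (¬_; Dec; yes; no; does)
open import Relation.Nullary.Decidable using (T?; dec-true; dec-false)

open import Defs

module ΣN = Sum NatP.+-0-commutativeMonoid

T-does⇒ : ∀ {P : Set} (d : Dec P) → T (does d) → P
T-does⇒ (yes p) _ = p

T-not-does⇒ : ∀ {P : Set} (d : Dec P) → T (not (does d)) → ¬ P
T-not-does⇒ (no ¬p) _ = ¬p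

T-does⇐ : ∀ {P : Set} (d : Dec P) → P → T (does d)
T-does⇐ d p = Equivalence.from BoolP.T-≡ (dec-true d p)

if-true : ∀ {A : Set} {b} {x y : A} → b ≡ true → (if b then x else y) ≡ x
if-true refl = refl

if-false : ∀ {A : Set} {b} {x y : A} → b ≡ false → (if b then x else y) ≡ y
if-false refl = refl

is-just≡false⇒nothing : ∀ {x : Maybe Bool} → is-just x ≡ false → x ≡ nothing
is-just≡false⇒nothing {nothing} _ = refl

is-just≡true⇒just : ∀ {x : Maybe Bool} → is-just x ≡ true → ∃ λ b → x ≡ just b
is-just≡true⇒just {just b} _ = b , refl

distinct-signs : ∀ {x y : Maybe Bool} s → x ≢ y → is-just x ≡ true → is-just y ≡ true → x ≡ just s ⊎ y ≡ just s
distinct-signs {just a} {just b} s x≢y _ _ with a BoolP.≟ s | b BoolP.≟ s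
... | yes refl | _ = inj₁ refl
... | _ | yes refl = inj₂ refl
... | no a≢s | no b≢s = ⊥-elim (x≢y (cong just (trans (BoolP.¬-not a≢s) (sym (BoolP.¬-not b≢s)))))

≡-lookup : ∀ {A : Set} {n} {u v : Vec A n} → (∀ i → lookup u i ≡ lookup v i) → u ≡ v
≡-lookup p = Pointwise-≡⇒≡ (ext p)

tabulate-≢ : ∀ {n} (g h : Fin n → Bool) i → g i ≡ false → h i ≡ true → tabulate g ≢ tabulate h
tabulate-≢ g h i gi hi e with trans (sym gi) (trans (sym (VecP.lookup∘tabulate g i))
  (trans (cong (λ v → lookup v i) e) (trans (VecP.lookup∘tabulate h i) hi)))
... | ()

∀-↑ : ∀ {m n} {P : Fin (m + n) → Set} → (∀ i → P (i ↑ˡ n)) → (∀ i → P (m ↑ʳ i)) → ∀ j → P j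
∀-↑ {m} {n} {P} left right j with splitAt m j in eq
... | inj₁ i = subst P (FinP.splitAt⁻¹-↑ˡ eq) (left i)
... | inj₂ i = subst P (FinP.splitAt⁻¹-↑ʳ eq) (right i)

lookup-supp : ∀ {n} (C : Clause n) i → lookup (supp C) i ≡ is-just (lookup C i)
lookup-supp C i = VecP.lookup-map i is-just C

supp≡⇒is-just≡ : ∀ {n} {C D : Clause n} → supp C ≡ supp D → ∀ i → is-just (lookup C i) ≡ is-just (lookup D i)
supp≡⇒is-just≡ {C = C} {D} eq i = begin
  is-just (lookup C i)  ≡⟨ lookup-supp C i ⟨
  lookup (supp C) i     ≡⟨ cong (λ s → lookup s i) eq ⟩
  lookup (supp D) i     ≡⟨ lookup-supp D i ⟩
  is-just (lookup D i)  ∎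
  where open ≡-Reasoning

supp-≢ : ∀ {n} {C D : Clause n} i → is-just (lookup C i) ≡ false → is-just (lookup D i) ≡ true → supp C ≢ supp D
supp-≢ i Ci Di e with trans (sym Ci) (trans (supp≡⇒is-just≡ e i) Di)
... | ()

supp≡tabulate⇒ : ∀ {n} {C : Clause n} {h} → supp C ≡ tabulate h → ∀ i → is-just (lookup C i) ≡ h i
supp≡tabulate⇒ {C = C} {h} e i =
  trans (sym (lookup-supp C i)) (trans (cong (λ s → lookup s i) e) (VecP.lookup∘tabulate h i))

==C-refl : ∀ {n} (C : Clause n) → T (C ==C C)
==C-refl C = T-does⇐ (VecP.≡-dec (MaybeP.≡-dec BoolP._≟_) C C) refl

==C⇒≡ : ∀ {n} {C D : Clause n} → T (C ==C D) → C ≡ D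
==C⇒≡ {C = C} {D} = T-does⇒ (VecP.≡-dec (MaybeP.≡-dec BoolP._≟_) C D)

allClauses-complete : ∀ {n} (C : Clause n) → C ∈ allClauses n
allClauses-complete Vec.[] = here refl
allClauses-complete (x Vec.∷ C) = ∈-concatMap⁺ _ (Any.map (λ { refl → extend x }) (allClauses-complete C))
  where
  extend : ∀ x → (x Vec.∷ C) ∈ (nothing Vec.∷ C) ∷ (just true Vec.∷ C) ∷ (just false Vec.∷ C) ∷ []
  extend nothing = here refl
  extend (just true) = there (here refl)
  extend (just false) = there (there (here refl))

allChoices-complete : ∀ {n} (f : Vec Bool n) → f ∈ allChoices n
allChoices-complete Vec.[] = here refl
allChoices-complete (x Vec.∷ f) = ∈-concatMap⁺ _ (Any.map (λ { refl → extend x }) (allChoices-complete f))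
  where
  extend : ∀ x → (x Vec.∷ f) ∈ (false Vec.∷ f) ∷ (true Vec.∷ f) ∷ []
  extend false = here refl
  extend true = there (here refl)

fromList : ∀ {n} → List (Clause n) → Formula n
fromList Ds D = any (_==C D) Ds

∈⇒fromList : ∀ {n} {Ds : List (Clause n)} {D} → D ∈ Ds → T (fromList Ds D)
∈⇒fromList {D = D} D∈Ds = any⁺ _ (lose D∈Ds (==C-refl D))

fromList⇒∈ : ∀ {n} {Ds : List (Clause n)} {D} → T (fromList Ds D) → D ∈ Ds
fromList⇒∈ {Ds = Ds} t with find (any⁻ _ Ds t)
... | E , E∈Ds , E==D = subst (_∈ Ds) (==C⇒≡ E==D) E∈Ds

-- Reading clauses off type G

module _ {n} (G : Formula n) (S : Vec Bool n) where

  private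
    onS : Clause n → Bool
    onS C = G C ∧ (supp C ==S S)

    differs : Clause n → Clause n → Fin n → Bool
    differs C D i = not (does (MaybeP.≡-dec BoolP._≟_ (lookup C i) (lookup D i)))

    onS⇒ : ∀ {C} → T (onS C) → T (G C) × supp C ≡ S
    onS⇒ {C} t with Equivalence.to BoolP.T-∧ t
    ... | C∈G , C-on-S = C∈G , T-does⇒ (VecP.≡-dec BoolP._≟_ (supp C) S) C-on-S

  type-undirected : type G S ≡ undirected → ∃ λ C → T (G C) × supp C ≡ S
  type-undirected e with List.filterᵇ onS (allClauses n) | all-filter (T? ∘ onS) (allClauses n)
  type-undirected () | [] | _
  type-undirected e | C ∷ [] | onC ∷ [] = C , onS⇒ onC
  type-undirected e | C ∷ D ∷ [] | _ with diffs C D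
  type-undirected () | C ∷ D ∷ [] | _ | []
  type-undirected () | C ∷ D ∷ [] | _ | _ ∷ []
  type-undirected () | C ∷ D ∷ [] | _ | _ ∷ _ ∷ _
  type-undirected () | _ ∷ _ ∷ _ ∷ _ | _

  type-directed : ∀ {v} → type G S ≡ directed v →
    ∃ λ C → ∃ λ D → (T (G C) × supp C ≡ S) × (T (G D) × supp D ≡ S) × lookup C v ≢ lookup D v
  type-directed e with List.filterᵇ onS (allClauses n) | all-filter (T? ∘ onS) (allClauses n)
  type-directed () | [] | _
  type-directed () | C ∷ [] | _
  type-directed e | C ∷ D ∷ [] | onC ∷ onD ∷ [] with diffs C D | all-filter (T? ∘ differs C D) (List.allFin n)
  type-directed () | C ∷ D ∷ [] | _ | [] | _
  type-directed refl | C ∷ D ∷ [] | onC ∷ onD ∷ [] | v ∷ [] | Cv≢Dv ∷ [] =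
    C , D , onS⇒ onC , onS⇒ onD , T-not-does⇒ (MaybeP.≡-dec BoolP._≟_ (lookup C v) (lookup D v)) Cv≢Dv
  type-directed () | C ∷ D ∷ [] | _ | _ ∷ _ ∷ _ | _
  type-directed () | _ ∷ _ ∷ _ ∷ _ | _

mapEdge-undirected : ∀ {n m} (f : Fin n → Fin m) e → mapEdge f e ≡ undirected → e ≡ undirected
mapEdge-undirected f undirected _ = refl

mapEdge-directed : ∀ {n m} (f : Fin n → Fin m) e {w} → mapEdge f e ≡ directed w → ∃ λ v → e ≡ directed v × f v ≡ w
mapEdge-directed f (directed v) refl = v , refl , refl

-- The 2-blowup

-- The local function tabulated by blow can only be named through unification.
lookup-tabulate : ∀ {A : Set} {n} {g : Fin n → A} {v : Vec A n} → v ≡ tabulate g → ∀ i → lookup v i ≡ g i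
lookup-tabulate refl = VecP.lookup∘tabulate _

keepIf : Bool → Maybe Bool → Maybe Bool
keepIf b x = if b then x else nothing

copy : ∀ {n} → Vec Bool n → Fin n → Fin (n + n)
copy {n} f i = if lookup f i then n ↑ʳ i else i ↑ˡ n

module _ {n} (C : Clause n) (f : Vec Bool n) where

  lookup-blow-↑ˡ : ∀ i → lookup (blow C f) (i ↑ˡ n) ≡ keepIf (not (lookup f i)) (lookup C i)
  lookup-blow-↑ˡ i rewrite lookup-tabulate {v = blow C f} refl (i ↑ˡ n) | FinP.splitAt-↑ˡ n i n
    with lookup f i
  ... | true = refl
  ... | false = refl

  lookup-blow-↑ʳ : ∀ i → lookup (blow C f) (n ↑ʳ i) ≡ keepIf (lookup f i) (lookup C i)
  lookup-blow-↑ʳ i rewrite lookup-tabulate {v = blow C f} refl (n ↑ʳ i) | FinP.splitAt-↑ʳ n n i = refl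

  lookup-blow-copy : ∀ i → lookup (blow C f) (copy f i) ≡ lookup C i
  lookup-blow-copy i with lookup f i in fi
  ... | true = trans (lookup-blow-↑ʳ i) (cong (λ b → keepIf b (lookup C i)) fi)
  ... | false = trans (lookup-blow-↑ˡ i) (cong (λ b → keepIf (not b) (lookup C i)) fi)

keepIf-just : ∀ b x {y} → keepIf b x ≡ just y → T b × x ≡ just y
keepIf-just true x e = _ , e

keepIf-cong : ∀ b c x → is-just (keepIf b x) ≡ is-just (keepIf c x) → keepIf b x ≡ keepIf c x
keepIf-cong true true _ _ = refl
keepIf-cong false false _ _ = refl
keepIf-cong true false nothing _ = refl
keepIf-cong false true nothing _ = refl

is-just-keepIf : ∀ b x → is-just x ≡ is-just (keepIf (not b) x) ∨ is-just (keepIf b x)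
is-just-keepIf true x = refl
is-just-keepIf false nothing = refl
is-just-keepIf false (just _) = refl

copy-↑ˡ : ∀ {n} (f : Vec Bool n) i → lookup f i ≡ false → copy f i ≡ i ↑ˡ n
copy-↑ˡ {n} f i fi = cong (λ b → if b then n ↑ʳ i else i ↑ˡ n) fi

copy-↑ʳ : ∀ {n} (f : Vec Bool n) i → lookup f i ≡ true → copy f i ≡ n ↑ʳ i
copy-↑ʳ {n} f i fi = cong (λ b → if b then n ↑ʳ i else i ↑ˡ n) fi

is-just-blow : ∀ {n} (C : Clause n) f i →
  is-just (lookup C i) ≡ is-just (lookup (blow C f) (i ↑ˡ n)) ∨ is-just (lookup (blow C f) (n ↑ʳ i))
is-just-blow C f i = trans (is-just-keepIf (lookup f i) (lookup C i))
  (sym (cong₂ (λ x y → is-just x ∨ is-just y) (lookup-blow-↑ˡ C f i) (lookup-blow-↑ʳ C f i)))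

supp-blow⇒supp : ∀ {n} (C D : Clause n) f g → supp (blow C f) ≡ supp (blow D g) → supp C ≡ supp D
supp-blow⇒supp {n} C D f g eq = ≡-lookup λ i → begin
  lookup (supp C) i                                                   ≡⟨ lookup-supp C i ⟩
  is-just (lookup C i)                                                ≡⟨ is-just-blow C f i ⟩
  is-just (lookup (blow C f) (i ↑ˡ n)) ∨ is-just (lookup (blow C f) (n ↑ʳ i))
    ≡⟨ cong₂ _∨_ (supp≡⇒is-just≡ eq (i ↑ˡ n)) (supp≡⇒is-just≡ eq (n ↑ʳ i)) ⟩
  is-just (lookup (blow D g) (i ↑ˡ n)) ∨ is-just (lookup (blow D g) (n ↑ʳ i)) ≡⟨ is-just-blow D g i ⟨
  is-just (lookup D i)                                                ≡⟨ lookup-supp D i ⟨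
  lookup (supp D) i                                                   ∎
  where open ≡-Reasoning

blow-supp-injective : ∀ {n} (C : Clause n) f g → supp (blow C f) ≡ supp (blow C g) → blow C f ≡ blow C g
blow-supp-injective {n} C f g eq = ≡-lookup (∀-↑ left right)
  where
  same-support : ∀ {x y} j → lookup (blow C f) j ≡ x → lookup (blow C g) j ≡ y → is-just x ≡ is-just y
  same-support j refl refl = supp≡⇒is-just≡ eq j

  left : ∀ i → lookup (blow C f) (i ↑ˡ n) ≡ lookup (blow C g) (i ↑ˡ n)
  left i = trans (lookup-blow-↑ˡ C f i) (trans
    (keepIf-cong (not (lookup f i)) (not (lookup g i)) (lookup C i) (same-support (i ↑ˡ n) (lookup-blow-↑ˡ C f i) (lookup-blow-↑ˡ C g i)))
    (sym (lookup-blow-↑ˡ C g i)))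

  right : ∀ i → lookup (blow C f) (n ↑ʳ i) ≡ lookup (blow C g) (n ↑ʳ i)
  right i = trans (lookup-blow-↑ʳ C f i) (trans
    (keepIf-cong (lookup f i) (lookup g i) (lookup C i) (same-support (n ↑ʳ i) (lookup-blow-↑ʳ C f i) (lookup-blow-↑ʳ C g i)))
    (sym (lookup-blow-↑ʳ C g i)))

module _ {n} (α : Vec Bool (n + n)) (C : Clause n) (f : Vec Bool n) where

  satisfies-blow⁻ : Satisfies α (blow C f) → ∀ i b → lookup C i ≡ just b → lookup α (copy f i) ≡ b
  satisfies-blow⁻ sat i b Ci = sat (copy f i) b (trans (lookup-blow-copy C f i) Ci)

  satisfies-blow⁺ : (∀ i b → lookup C i ≡ just b → lookup α (copy f i) ≡ b) → Satisfies α (blow C f)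
  satisfies-blow⁺ sat = ∀-↑ left right
    where
    left : ∀ i b → lookup (blow C f) (i ↑ˡ n) ≡ just b → lookup α (i ↑ˡ n) ≡ b
    left i b e with keepIf-just (not (lookup f i)) (lookup C i) (trans (sym (lookup-blow-↑ˡ C f i)) e)
    ... | fi-false , Ci = subst (λ j → lookup α j ≡ b) (copy-↑ˡ f i (Equivalence.to BoolP.T-not-≡ fi-false)) (sat i b Ci)

    right : ∀ i b → lookup (blow C f) (n ↑ʳ i) ≡ just b → lookup α (n ↑ʳ i) ≡ b
    right i b e with keepIf-just (lookup f i) (lookup C i) (trans (sym (lookup-blow-↑ʳ C f i)) e)
    ... | fi-true , Ci = subst (λ j → lookup α j ≡ b) (copy-↑ʳ f i (Equivalence.to BoolP.T-≡ fi-true)) (sat i b Ci)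

blow∈blowup : ∀ {n} {G : Formula n} {C : Clause n} → T (G C) → ∀ f → T (blowup G (blow C f))
blow∈blowup {C = C} C∈G f =
  any⁺ _ (lose (allClauses-complete C) (Equivalence.from BoolP.T-∧ (C∈G ,
    any⁺ _ (lose (allChoices-complete f) (==C-refl (blow C f))))))

allOriginal : ∀ {n} → Vec Bool n
allOriginal {n} = replicate n false

duplicateOnly : ∀ {n} → Fin n → Vec Bool n
duplicateOnly v = tabulate (λ i → does (i FinP.≟ v))

lookup-duplicateOnly-self : ∀ {n} (v : Fin n) → lookup (duplicateOnly v) v ≡ true
lookup-duplicateOnly-self v = trans (VecP.lookup∘tabulate (λ i → does (i FinP.≟ v)) v) (dec-true (v FinP.≟ v) refl)

differ : Maybe Bool → Maybe Bool → Bool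
differ (just a) (just b) = a xor b
differ _ _ = false

disagreements : ∀ {n} → Clause n → Clause n → Vec Bool n
disagreements A C = tabulate (λ i → differ (lookup A i) (lookup C i))

satisfies-blow-allOriginal⁻ : ∀ {n} (α : Vec Bool (n + n)) (A : Clause n) → Satisfies α (blow A allOriginal) →
  ∀ i a → lookup A i ≡ just a → lookup α (i ↑ˡ n) ≡ a
satisfies-blow-allOriginal⁻ α A sat i a Ai =
  subst (λ j → lookup α j ≡ a) (copy-↑ˡ allOriginal i (VecP.lookup-replicate i false)) (satisfies-blow⁻ α A allOriginal sat i a Ai)

disagreeing-duplicates : ∀ {n} (α : Vec Bool (n + n)) (A : Clause n) → ¬ (∃ λ v → lookup A v ≡ just (lookup α (n ↑ʳ v))) →
  ∀ i a → lookup A i ≡ just a → lookup α (n ↑ʳ i) ≡ not a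
disagreeing-duplicates α A agreeing i a Ai = BoolP.¬-not λ αi → agreeing (i , trans Ai (cong just (sym αi)))

blow-allOriginal≢blow-duplicateOnly : ∀ {n} (A : Clause n) v {a} → lookup A v ≡ just a →
  blow A allOriginal ≢ blow A (duplicateOnly v)
blow-allOriginal≢blow-duplicateOnly {n} A v Av = supp-≢ (n ↑ʳ v)
  (cong is-just (trans (lookup-blow-↑ʳ A allOriginal v) (cong (λ b → keepIf b (lookup A v)) (VecP.lookup-replicate v false))))
  (cong is-just (trans (lookup-blow-↑ʳ A (duplicateOnly v) v) (trans (cong (λ b → keepIf b (lookup A v)) (lookup-duplicateOnly-self v)) Av)))
  ∘ cong supp

module _ {n} (α : Vec Bool (n + n)) (A : Clause n)
  (originals : ∀ i a → lookup A i ≡ just a → lookup α (i ↑ˡ n) ≡ a) where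

  satisfies-blow-duplicateOnly : ∀ v → lookup A v ≡ just (lookup α (n ↑ʳ v)) → Satisfies α (blow A (duplicateOnly v))
  satisfies-blow-duplicateOnly v Av = satisfies-blow⁺ α A (duplicateOnly v) on-copy
    where
    on-copy : ∀ i b → lookup A i ≡ just b → lookup α (copy (duplicateOnly v) i) ≡ b
    on-copy i b Ai rewrite VecP.lookup∘tabulate (λ i → does (i FinP.≟ v)) i with i FinP.≟ v
    ... | yes refl = MaybeP.just-injective (trans (sym Av) Ai)
    ... | no _ = originals i b Ai

  satisfies-blow-disagreements : (∀ i a → lookup A i ≡ just a → lookup α (n ↑ʳ i) ≡ not a) →
    ∀ C → (∀ i b → lookup A i ≡ nothing → lookup C i ≡ just b → lookup α (i ↑ˡ n) ≡ b) →
    Satisfies α (blow C (disagreements A C))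
  satisfies-blow-disagreements duplicates C holes = satisfies-blow⁺ α C (disagreements A C) on-copy
    where
    on-copy : ∀ i b → lookup C i ≡ just b → lookup α (copy (disagreements A C) i) ≡ b
    on-copy i b Ci rewrite VecP.lookup∘tabulate (λ i → differ (lookup A i) (lookup C i)) i | Ci
      with lookup A i in Ai
    ... | nothing = holes i b Ai Ci
    ... | just a with a | b
    ...   | true | true = originals i true Ai
    ...   | true | false = duplicates i true Ai
    ...   | false | true = duplicates i false Ai
    ...   | false | false = originals i false Ai

-- A simple non-minimal subformula of the blowup

record TkTriple {n} (G : Formula n) : Set where
  field
    pivot : Fin n
    A B C : Clause n
    A∈G : T (G A)
    B∈G : T (G B)
    C∈G : T (G C)
    A-omits-pivot : lookup A pivot ≡ nothing
    A-omits-only-pivot : ∀ i → lookup A i ≡ nothing → i ≡ pivot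
    sign : Bool
    B-pivot : lookup B pivot ≡ just sign
    C-pivot : lookup C pivot ≡ just (not sign)
    supp-B≢supp-C : supp B ≢ supp C

module _ {n} {G : Formula n} (triple : TkTriple G) where
  open TkTriple triple

  bases : List (Clause n)
  bases = A ∷ B ∷ C ∷ []

  bases⊆G : ∀ {Z} → Z ∈ bases → T (G Z)
  bases⊆G (here refl) = A∈G
  bases⊆G (there (here refl)) = B∈G
  bases⊆G (there (there (here refl))) = C∈G

  supp-A≢ : ∀ {Z b} → lookup Z pivot ≡ just b → supp A ≢ supp Z
  supp-A≢ Zp = supp-≢ pivot (cong is-just A-omits-pivot) (cong is-just Zp)

  bases-supp-injective : ∀ {Z W} → Z ∈ bases → W ∈ bases → supp Z ≡ supp W → Z ≡ W
  bases-supp-injective (here refl) (here refl) _ = refl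
  bases-supp-injective (here refl) (there (here refl)) e = ⊥-elim (supp-A≢ B-pivot e)
  bases-supp-injective (here refl) (there (there (here refl))) e = ⊥-elim (supp-A≢ C-pivot e)
  bases-supp-injective (there (here refl)) (here refl) e = ⊥-elim (supp-A≢ B-pivot (sym e))
  bases-supp-injective (there (here refl)) (there (here refl)) _ = refl
  bases-supp-injective (there (here refl)) (there (there (here refl))) e = ⊥-elim (supp-B≢supp-C e)
  bases-supp-injective (there (there (here refl))) (here refl) e = ⊥-elim (supp-A≢ C-pivot (sym e))
  bases-supp-injective (there (there (here refl))) (there (here refl)) e = ⊥-elim (supp-B≢supp-C (sym e))
  bases-supp-injective (there (there (here refl))) (there (there (here refl))) _ = refl

  blownClauses : List (Clause (n + n))
  blownClauses = blow A allOriginal ∷ blow B (disagreements A B) ∷ blow C (disagreements A C)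
               ∷ List.map (λ v → blow A (duplicateOnly v)) (List.allFin n)

  H : Formula (n + n)
  H = fromList blownClauses

  ∈H : ∀ {D} → D ∈ blownClauses → T (H D)
  ∈H = ∈⇒fromList {Ds = blownClauses}

  H-blown : ∀ D → T (H D) → ∃ λ Z → ∃ λ f → Z ∈ bases × D ≡ blow Z f
  H-blown D D∈H with fromList⇒∈ {Ds = blownClauses} D∈H
  ... | here refl = A , allOriginal , here refl , refl
  ... | there (here refl) = B , disagreements A B , there (here refl) , refl
  ... | there (there (here refl)) = C , disagreements A C , there (there (here refl)) , refl
  ... | there (there (there D∈)) with ∈-map⁻ _ D∈
  ...   | v , _ , refl = A , duplicateOnly v , here refl , refl

  H⊆blowup : H ⊆F blowup G
  H⊆blowup D D∈H with H-blown D D∈H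
  ... | Z , f , Z∈ , refl = blow∈blowup (bases⊆G Z∈) f

  H-simple : Simple H
  H-simple D D' D∈H D'∈H eq with H-blown D D∈H | H-blown D' D'∈H
  ... | Z , f , Z∈ , refl | W , g , W∈ , refl with bases-supp-injective Z∈ W∈ (supp-blow⇒supp Z W f g eq)
  ... | refl = blow-supp-injective Z f g eq

  pivot-hole : ∀ (α : Vec Bool (n + n)) Z {s} → lookup Z pivot ≡ just s → lookup α (pivot ↑ˡ n) ≡ s →
    ∀ i b → lookup A i ≡ nothing → lookup Z i ≡ just b → lookup α (i ↑ˡ n) ≡ b
  pivot-hole α Z Zp αp i b Ai Zi with A-omits-only-pivot i Ai
  ... | refl = trans αp (MaybeP.just-injective (trans (sym Zp) Zi))

  blow-A≢ : ∀ {Z s} f g → lookup Z pivot ≡ just s → blow A f ≢ blow Z g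
  blow-A≢ {Z} f g Zp = supp-A≢ Zp ∘ supp-blow⇒supp A Z f g ∘ cong supp

  another-satisfied : ∀ (α : Vec Bool (n + n)) → Satisfies α (blow A allOriginal) →
    ∃ λ D → T (H D) × D ≢ blow A allOriginal × Satisfies α D
  another-satisfied α sat with FinP.any? (λ v → MaybeP.≡-dec BoolP._≟_ (lookup A v) (just (lookup α (n ↑ʳ v))))
  ... | yes (v , Av) = _ , ∈H (there (there (there (∈-map⁺ _ (∈-allFin v))))) ,
    blow-allOriginal≢blow-duplicateOnly A v Av ∘ sym ,
    satisfies-blow-duplicateOnly α A (satisfies-blow-allOriginal⁻ α A sat) v Av
  ... | no agreeing with lookup α (pivot ↑ˡ n) BoolP.≟ sign
  ...   | yes αp = _ , ∈H (there (here refl)) , blow-A≢ allOriginal _ B-pivot ∘ sym ,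
    satisfies-blow-disagreements α A (satisfies-blow-allOriginal⁻ α A sat) (disagreeing-duplicates α A agreeing)
      B (pivot-hole α B B-pivot αp)
  ...   | no αp = _ , ∈H (there (there (here refl))) , blow-A≢ allOriginal _ C-pivot ∘ sym ,
    satisfies-blow-disagreements α A (satisfies-blow-allOriginal⁻ α A sat) (disagreeing-duplicates α A agreeing)
      C (pivot-hole α C C-pivot (BoolP.¬-not αp))

  H-not-minimal : ¬ Minimal H
  H-not-minimal minimal with minimal (blow A allOriginal) (∈H (here refl))
  ... | α , sat , exclusive with another-satisfied α sat
  ... | D , D∈H , D≢E , satD = exclusive D D∈H D≢E satD

  blowup-has-simple-non-minimal : Σ (Formula (n + n)) λ H → (H ⊆F blowup G) × Simple H × ¬ Minimal H
  blowup-has-simple-non-minimal = H , H⊆blowup , H-simple , H-not-minimal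

card-tabulate : ∀ {n} (g : Fin n → Bool) → card (tabulate g) ≡ ΣN.sum (λ i → if g i then 1 else 0)
card-tabulate {zero} g = refl
card-tabulate {suc n} g with g Fin.zero
... | true = cong suc (card-tabulate (g ∘ Fin.suc))
... | false = card-tabulate (g ∘ Fin.suc)

card-permute : ∀ {n m} (σ : Fin n ↔ Fin m) (g : Fin m → Bool) → card (tabulate (g ∘ Inverse.to σ)) ≡ card (tabulate g)
card-permute σ g = begin
  card (tabulate (g ∘ Inverse.to σ))                    ≡⟨ card-tabulate (g ∘ Inverse.to σ) ⟩
  ΣN.sum (λ i → if g (Inverse.to σ i) then 1 else 0)   ≡⟨ ΣN.sum-permute (λ i → if g i then 1 else 0) σ ⟨
  ΣN.sum (λ i → if g i then 1 else 0)                   ≡⟨ card-tabulate g ⟨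
  card (tabulate g)                                     ∎
  where open ≡-Reasoning

card-all : ∀ {n} (g : Fin n → Bool) → (∀ i → g i ≡ true) → card (tabulate g) ≡ n
card-all {zero} g _ = refl
card-all {suc n} g all rewrite all Fin.zero = cong suc (card-all (g ∘ Fin.suc) (all ∘ Fin.suc))

omit : ∀ {n} → ℕ → Fin n → Bool
omit c i = not (toℕ i ≡ᵇ c)

card-omit : ∀ n c → c ≤ n → card (tabulate (omit {suc n} c)) ≡ n
card-omit n zero _ = card-all (omit 0 ∘ Fin.suc) (λ _ → refl)
card-omit (suc n) (suc c) (s≤s c≤n) = cong suc (card-omit n c c≤n)

omit-≡ : ∀ {n} {i : Fin n} {c} → toℕ i ≡ c → omit c i ≡ false
omit-≡ {i = i} {c} e = cong not (Equivalence.to BoolP.T-≡ (NatP.≡⇒≡ᵇ (toℕ i) c e))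

omit-false : ∀ {n} {i : Fin n} {c} → omit c i ≡ false → toℕ i ≡ c
omit-false {i = i} {c} e = NatP.≡ᵇ⇒≡ (toℕ i) c (Equivalence.from BoolP.T-≡ (BoolP.not-injective e))

omit-≢ : ∀ {n} {i : Fin n} {c} → toℕ i ≢ c → omit c i ≡ true
omit-≢ ne = BoolP.¬-not (ne ∘ omit-false)

module _ (m : ℕ) where
  private
    K : ℕ
    K = suc (suc m)

  -- Vertices k+1 and k of the paper: Tk numbers its vertices from 0.
  top : Fin (suc K)
  top = fromℕ K

  penultimate : Fin (suc K)
  penultimate = inject₁ (fromℕ (suc m))

  toℕ-top : toℕ top ≡ K
  toℕ-top = FinP.toℕ-fromℕ K

  toℕ-penultimate : toℕ penultimate ≡ suc m
  toℕ-penultimate = trans (FinP.toℕ-inject₁ (fromℕ (suc m))) (FinP.toℕ-fromℕ (suc m))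

  omit-K-top : omit K top ≡ false
  omit-K-top = omit-≡ toℕ-top

  omit-1+m-top : omit (suc m) top ≡ true
  omit-1+m-top = omit-≢ λ e → NatP.1+n≢n (trans (sym toℕ-top) e)

  private
    S₁ S₂ S₃ : Vec Bool (suc K)
    S₁ = tabulate (omit K)
    S₂ = tabulate (omit 0)
    S₃ = tabulate (omit (suc m))

    S₁≢S₂ : S₁ ≢ S₂
    S₁≢S₂ = tabulate-≢ (omit K) (omit 0) top omit-K-top refl

    S₁≢S₃ : S₁ ≢ S₃
    S₁≢S₃ = tabulate-≢ (omit K) (omit (suc m)) top omit-K-top omit-1+m-top

    S₂≢S₃ : S₂ ≢ S₃
    S₂≢S₃ = tabulate-≢ (omit 0) (omit (suc m)) Fin.zero refl refl

    ≟S : (S S′ : Vec Bool (suc K)) → Dec (S ≡ S′)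
    ≟S = VecP.≡-dec BoolP._≟_

  Tk-S₁ : Tk K S₁ ≡ undirected
  Tk-S₁ = if-true {b = S₁ ==S S₁} (dec-true (≟S S₁ S₁) refl)

  Tk-S₂ : Tk K S₂ ≡ undirected
  Tk-S₂ = trans (if-false {b = S₂ ==S S₁} {x = undirected} (dec-false (≟S S₂ S₁) (S₁≢S₂ ∘ sym)))
                (if-true {b = S₂ ==S S₂} {y = if S₂ ==S S₃ then directed top else none} (dec-true (≟S S₂ S₂) refl))

  Tk-S₃ : Tk K S₃ ≡ directed top
  Tk-S₃ = trans (if-false {b = S₃ ==S S₁} {x = undirected} (dec-false (≟S S₃ S₁) (S₁≢S₃ ∘ sym)))
         (trans (if-false {b = S₃ ==S S₂} {x = undirected} (dec-false (≟S S₃ S₂) (S₂≢S₃ ∘ sym)))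
                (if-true {b = S₃ ==S S₃} {y = none} (dec-true (≟S S₃ S₃) refl)))

-- Pulling the edges of T_k back along the isomorphism

≅-edge : ∀ {n m k} {P : PDG n} {Q : PDG m} (iso : P ≅[ k ] Q) (g : Fin m → Bool) → card (tabulate g) ≡ k →
  Q (tabulate g) ≡ mapEdge (Inverse.to (proj₁ iso)) (P (tabulate (g ∘ Inverse.to (proj₁ iso))))
≅-edge {P = P} {Q} (σ , edges) g c =
  subst (λ S → Q S ≡ mapEdge (Inverse.to σ) (P (tabulate (g ∘ Inverse.to σ)))) pushforward
    (edges (tabulate (g ∘ Inverse.to σ)) (trans (card-permute σ g) c))
  where
  pushforward : tabulate (λ j → lookup (tabulate (g ∘ Inverse.to σ)) (Inverse.from σ j)) ≡ tabulate g
  pushforward = VecP.tabulate-cong λ j →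
    trans (VecP.lookup∘tabulate (g ∘ Inverse.to σ) (Inverse.from σ j)) (cong g (Inverse.strictlyInverseˡ σ j))

module _ {m n} {G : Formula n} (iso : type G ≅[ suc (suc m) ] Tk (suc (suc m))) where
  private
    K : ℕ
    K = suc (suc m)

    to : Fin n → Fin (suc K)
    to = Inverse.to (proj₁ iso)

    from : Fin (suc K) → Fin n
    from = Inverse.from (proj₁ iso)

    preimage : ℕ → Vec Bool n
    preimage c = tabulate (omit c ∘ to)

    edge : ∀ c → c ≤ K → Tk K (tabulate (omit c)) ≡ mapEdge to (type G (preimage c))
    edge c c≤K = ≅-edge {P = type G} {Q = Tk K} iso (omit c) (card-omit K c c≤K)

    pivot : Fin n
    pivot = from (top m)

    is-just-at : ∀ {C} c → supp C ≡ preimage c → ∀ y → is-just (lookup C (from y)) ≡ omit c y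
    is-just-at c e y = trans (supp≡tabulate⇒ e (from y)) (cong (omit c) (Inverse.strictlyInverseˡ (proj₁ iso) y))

    omits-only-pivot : ∀ {A} → supp A ≡ preimage K → ∀ i → lookup A i ≡ nothing → i ≡ pivot
    omits-only-pivot e i Ai = begin
      i                ≡⟨ Inverse.strictlyInverseʳ (proj₁ iso) i ⟨
      from (to i)      ≡⟨ cong from (FinP.toℕ-injective (trans (omit-false omit-i) (sym (toℕ-top m)))) ⟩
      from (top m)     ∎
      where
      open ≡-Reasoning
      omit-i : omit K (to i) ≡ false
      omit-i = trans (sym (supp≡tabulate⇒ e i)) (cong is-just Ai)

    clause-with-sign : ∀ {v} → type G (preimage (suc m)) ≡ directed v → to v ≡ top m →
      ∀ s → ∃ λ C → (T (G C) × supp C ≡ preimage (suc m)) × lookup C pivot ≡ just s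
    clause-with-sign {v} toward-v to-v s with type-directed G (preimage (suc m)) toward-v
    ... | C₁ , C₂ , (C₁∈G , supp-C₁) , (C₂∈G , supp-C₂) , C₁≢C₂
      with distinct-signs s (subst (λ i → lookup C₁ i ≢ lookup C₂ i) v≡pivot C₁≢C₂)
             (trans (is-just-at (suc m) supp-C₁ (top m)) (omit-1+m-top m))
             (trans (is-just-at (suc m) supp-C₂ (top m)) (omit-1+m-top m))
      where
      v≡pivot : v ≡ pivot
      v≡pivot = trans (sym (Inverse.strictlyInverseʳ (proj₁ iso) v)) (cong from to-v)
    ... | inj₁ C₁-pivot = C₁ , (C₁∈G , supp-C₁) , C₁-pivot
    ... | inj₂ C₂-pivot = C₂ , (C₂∈G , supp-C₂) , C₂-pivot

  type≅Tk⇒TkTriple : TkTriple G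
  type≅Tk⇒TkTriple
    with type-undirected G (preimage K) (mapEdge-undirected to _ (trans (sym (edge K NatP.≤-refl)) (Tk-S₁ m)))
       | type-undirected G (preimage 0) (mapEdge-undirected to _ (trans (sym (edge 0 z≤n)) (Tk-S₂ m)))
       | mapEdge-directed to _ (trans (sym (edge (suc m) (NatP.n≤1+n (suc m)))) (Tk-S₃ m))
  ... | A , A∈G , supp-A | B , B∈G , supp-B | v , toward-v , to-v
    with is-just≡true⇒just (is-just-at 0 supp-B (top m))
  ... | sign , B-pivot with clause-with-sign toward-v to-v (not sign)
  ... | C , (C∈G , supp-C) , C-pivot = record
    { pivot = pivot ; A = A ; B = B ; C = C ; A∈G = A∈G ; B∈G = B∈G ; C∈G = C∈G
    ; A-omits-pivot = is-just≡false⇒nothing (trans (is-just-at K supp-A (top m)) (omit-K-top m))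
    ; A-omits-only-pivot = omits-only-pivot supp-A
    ; sign = sign ; B-pivot = B-pivot ; C-pivot = C-pivot
    ; supp-B≢supp-C = supp-≢ (from (penultimate m))
        (trans (is-just-at (suc m) supp-C (penultimate m)) (omit-≡ (toℕ-penultimate m)))
        (is-just-at 0 supp-B (penultimate m)) ∘ sym
    }

proposition4p8 : (k n : ℕ) → 2 ≤ k → (G : Formula n) → IsKFormula k G → Semisimple G →
    type G ≅[ k ] Tk k →
    Σ (Formula (n + n)) λ H → (H ⊆F blowup G) × Simple H × ¬ Minimal H
proposition4p8 (suc (suc m)) n (s≤s (s≤s z≤n)) G _ _ iso = blowup-has-simple-non-minimal (type≅Tk⇒TkTriple iso)
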